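{- Fix positive integers $t$ and $\Delta$, and for $1\le i\le t$, $1\le d\le\Delta$ let $Z_{i,d}=(4t\Delta)^{2t\Delta+(i\Delta+d)}+(4t\Delta)^{5t\Delta-(i\Delta+d)}$; let $\mathcal Z=\{Z_{i,d}\mid 1\le i\le t,\ 1\le d\le\Delta\}$. If $A$ is a subset of $\mathcal Z$ and $\mathcal B$ is a multiset of elements of $\mathcal Z$ such that $\left|\sum_{S\in A}S-\sum_{S\in\mathcal B}S\right|<(4t\Delta)^{2t\Delta}$ (the second sum counted with multiplicity), then $\mathcal B$ is a set (every element has multiplicity one) and $\mathcal B=A$. -}

module Defs where

open import Data.Nat using (ℕ; _+_; _*_; _∸_; _^_; _≤_)
open import Data.Product using (∃-syntax; _×_)
open import Relation.Binary.PropositionalEquality using (_≡_)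

-- Z_{i,d} = (4tΔ)^(2tΔ + (iΔ + d)) + (4tΔ)^(5tΔ - (iΔ + d)).
-- (For 1 ≤ i ≤ t, 1 ≤ d ≤ Δ we have iΔ + d ≤ 2tΔ < 5tΔ, so ∸ is true subtraction.)
Z : (t Δ i d : ℕ) → ℕ
Z t Δ i d = (4 * t * Δ) ^ (2 * t * Δ + (i * Δ + d))
          + (4 * t * Δ) ^ (5 * t * Δ ∸ (i * Δ + d))

InZ : (t Δ x : ℕ) → Set
InZ t Δ x = ∃[ i ] ∃[ d ] (1 ≤ i × i ≤ t × 1 ≤ d × d ≤ Δ × x ≡ Z t Δ i d)

module Submission where

-- Every element of 𝒵 is N^a + N^b with N = 4tΔ, a + b = s = 7tΔ and a, b > 2tΔ.
--
-- (1) Divisibility: both sums are multiples of N^(2tΔ+1), which exceeds their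
--     distance, so they are equal ('∣-∣<⇒≡').
-- (2) Equal sums of "pairs" determine the multiset ('pair-sums-determine'):
--     for a base N ≥ 3, a pair below h is N^p + N^q with 1 ≤ p ≤ q, p + q = s,
--     q < h.  If a duplicate-free list A and a list B of pairs below h have
--     equal sums, B is duplicate-free and a permutation of A.  Induction on h,
--     looking at the largest candidate top h = N^(s∸h) + N^h:
--       * distinct pairs below h sum to less than N^h ≤ top h, so top h
--         cannot occur in B without occurring in A;
--       * all other pairs below h+1 are multiples of N^(s∸h+1) while top h is
--         not, so top h cannot occur in A without occurring in B;
--       * if it occurs in both, it occurs once in each; cancel it and recurse.

open import Defs
open import Data.Nat
  using (ℕ; zero; suc; _+_; _*_; _∸_; _^_; _<_; _≤_; ∣_-_∣; NonZero; >-nonZero; z≤n; s≤s; _≤?_; _≟_)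
open import Data.Nat.Properties
open import Data.Nat.Divisibility using (_∣_; _∤_; _∣0; m∣m*n; ∣m∣n⇒∣m+n; ∣m+n∣m⇒∣n; >⇒∤)
open import Data.Nat.ListAction using (sum)
open import Data.Nat.ListAction.Properties using (sum-↭)
open import Data.Nat.Tactic.RingSolver using (solve-∀)
open import Data.List using (List; []; _∷_; _++_)
open import Data.List.Relation.Unary.All as All using (All; []; _∷_)
open import Data.List.Relation.Unary.All.Properties.Core using (¬Any⇒All¬)
open import Data.List.Relation.Unary.Any using (here; there)
open import Data.List.Relation.Unary.AllPairs as AllPairs using ([]; _∷_)
open import Data.List.Relation.Unary.Unique.Propositional using (Unique)
open import Data.List.Relation.Unary.Unique.Propositional.Properties using (Unique[x∷xs]⇒x∉xs)
open import Data.List.Relation.Binary.Permutation.Propositional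
  using (_↭_; ↭-refl; ↭-sym; ↭-trans; ↭-prep; ↭⇒↭ₛ)
open import Data.List.Relation.Binary.Permutation.Propositional.Properties using (All-resp-↭; shift)
import Data.List.Relation.Binary.Permutation.Setoid.Properties as SetoidPerm
open import Data.List.Membership.Propositional using (_∈_; _∉_)
open import Data.List.Membership.Propositional.Properties using (∈-∃++)
open import Data.List.Membership.DecPropositional _≟_ using (_∈?_)
open import Data.Product using (∃-syntax; _×_; _,_)
open import Data.Sum using (inj₁; inj₂)
open import Function using (_∘_)
open import Relation.Nullary using (yes; no; contradiction)
open import Relation.Nullary.Decidable using (decidable-stable)
open import Relation.Binary.PropositionalEquality
  using (_≡_; _≢_; refl; sym; trans; cong; subst; setoid)

module _ {A : Set} where

  ∈⇒↭∷ : ∀ {x : A} {xs} → x ∈ xs → ∃[ ys ] (xs ↭ x ∷ ys)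
  ∈⇒↭∷ {x} x∈xs with ys , zs , refl ← ∈-∃++ x∈xs = ys ++ zs , shift x ys zs

  Unique-resp-↭ : ∀ {xs ys : List A} → xs ↭ ys → Unique xs → Unique ys
  Unique-resp-↭ σ = SetoidPerm.Unique-resp-↭ (setoid A) (↭⇒↭ₛ σ)

  restore-head : ∀ {x : A} {A' B' As Bs} → As ↭ x ∷ A' → Bs ↭ x ∷ B' → x ∉ B' →
                 Unique B' × (B' ↭ A') → Unique Bs × (Bs ↭ As)
  restore-head {x} {B' = B'} As↭ Bs↭ x∉B' (uB' , B'↭A') =
    Unique-resp-↭ (↭-sym Bs↭) (¬Any⇒All¬ B' x∉B' ∷ uB') ,
    ↭-trans Bs↭ (↭-trans (↭-prep x B'↭A') (↭-sym As↭))

^-∣ : ∀ N {a b} → a ≤ b → N ^ a ∣ N ^ b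
^-∣ N {a} {b} a≤b = subst (N ^ a ∣_) N^a*N^[b∸a]≡N^b (m∣m*n (N ^ (b ∸ a)))
  where
  N^a*N^[b∸a]≡N^b : N ^ a * N ^ (b ∸ a) ≡ N ^ b
  N^a*N^[b∸a]≡N^b = trans (sym (^-distribˡ-+-* N a (b ∸ a))) (cong (N ^_) (m+[n∸m]≡n a≤b))

sum-∣ : ∀ {d} {xs : List ℕ} → All (d ∣_) xs → d ∣ sum xs
sum-∣ []            = _ ∣0
sum-∣ (d∣x ∷ d∣xs) = ∣m∣n⇒∣m+n d∣x (sum-∣ d∣xs)

∸-∣ : ∀ {d m n} → d ∣ m → d ∣ n → d ∣ m ∸ n
∸-∣ {d} {m} {n} d∣m d∣n with ≤-total n m
... | inj₁ n≤m = ∣m+n∣m⇒∣n (subst (d ∣_) (sym (m+[n∸m]≡n n≤m)) d∣m) d∣n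
... | inj₂ m≤n = subst (d ∣_) (sym (m≤n⇒m∸n≡0 m≤n)) (d ∣0)

∣-∣-∣ : ∀ {d m n} → d ∣ m → d ∣ n → d ∣ ∣ m - n ∣
∣-∣-∣ {d} {m} {n} d∣m d∣n with ∣m-n∣≡[m∸n]∨[n∸m] m n
... | inj₁ eq = subst (d ∣_) (sym eq) (∸-∣ d∣m d∣n)
... | inj₂ eq = subst (d ∣_) (sym eq) (∸-∣ d∣n d∣m)

∣∧<⇒≡0 : ∀ {d n} → d ∣ n → n < d → n ≡ 0
∣∧<⇒≡0 {n = zero}  _   _   = refl
∣∧<⇒≡0 {n = suc n} d∣n n<d = contradiction d∣n (>⇒∤ n<d)

∣-∣<⇒≡ : ∀ {d m n} → d ∣ m → d ∣ n → ∣ m - n ∣ < d → m ≡ n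
∣-∣<⇒≡ d∣m d∣n close = ∣m-n∣≡0⇒m≡n (∣∧<⇒≡0 (∣-∣-∣ d∣m d∣n) close)

TwoPowers : (N s L x : ℕ) → Set
TwoPowers N s L x = ∃[ a ] ∃[ b ] (L ≤ a × L ≤ b × a + b ≡ s × x ≡ N ^ a + N ^ b)

TwoPowers-∣ : ∀ {N s L x} → TwoPowers N s L x → N ^ L ∣ x
TwoPowers-∣ {N} (a , b , L≤a , L≤b , _ , refl) = ∣m∣n⇒∣m+n (^-∣ N L≤a) (^-∣ N L≤b)

module PairSums (N s : ℕ) (3≤N : 3 ≤ N) where

  instance
    N≢0 : NonZero N
    N≢0 = >-nonZero (≤-trans (s≤s z≤n) 3≤N)

  Pair : ℕ → ℕ → Set
  Pair h x = ∃[ p ] ∃[ q ] (1 ≤ p × p ≤ q × p + q ≡ s × q < h × x ≡ N ^ p + N ^ q)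

  top : ℕ → ℕ
  top h = N ^ (s ∸ h) + N ^ h

  -- Three copies of N^p fit below the next power: the room that keeps
  -- distinct pairs from carrying.
  thrice≤^suc : ∀ p → N ^ p + N ^ p + N ^ p ≤ N ^ suc p
  thrice≤^suc p = begin
    N ^ p + N ^ p + N ^ p ≡⟨ triple (N ^ p) ⟩
    3 * N ^ p             ≤⟨ *-monoˡ-≤ (N ^ p) 3≤N ⟩
    N ^ suc p             ∎
    where
    open ≤-Reasoning
    triple : ∀ x → x + x + x ≡ 3 * x
    triple = solve-∀

  -- N^(p+1) never divides N^p + N^h: if h > p it would divide N^p, and
  -- otherwise N^p + N^h ≤ 2·N^p is a positive number below N^(p+1).
  ^-suc-∤ : ∀ p h → N ^ suc p ∤ N ^ p + N ^ h
  ^-suc-∤ p h with suc p ≤? h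
  ... | yes p<h = λ N^[1+p]∣ → >⇒∤ {{m^n≢0 N p}} N^p<N^[1+p]
                    (∣m+n∣m⇒∣n (subst (N ^ suc p ∣_) (+-comm (N ^ p) (N ^ h)) N^[1+p]∣) (^-∣ N p<h))
    where
    N^p<N^[1+p] : N ^ p < N ^ suc p
    N^p<N^[1+p] = ^-monoʳ-< N (≤-trans (s≤s (s≤s z≤n)) 3≤N) (n<1+n p)
  ... | no p≮h = >⇒∤ {{>-nonZero (<-≤-trans (m^n>0 N p) (m≤m+n (N ^ p) (N ^ h)))}} sum<N^[1+p]
    where
    open ≤-Reasoning
    sum<N^[1+p] : N ^ p + N ^ h < N ^ suc p
    sum<N^[1+p] = begin-strict
      N ^ p + N ^ h         ≤⟨ +-monoʳ-≤ (N ^ p) (^-monoʳ-≤ N (≤-pred (≰⇒> p≮h))) ⟩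
      N ^ p + N ^ p         <⟨ m<m+n (N ^ p + N ^ p) (m^n>0 N p) ⟩
      N ^ p + N ^ p + N ^ p ≤⟨ thrice≤^suc p ⟩
      N ^ suc p             ∎

  TwoPowers⇒Pair : ∀ {L x} → TwoPowers N s (suc L) x → Pair (suc s) x
  TwoPowers⇒Pair (a , b , L<a , L<b , a+b≡s , refl) with ≤-total a b
  ... | inj₁ a≤b = a , b , ≤-trans (s≤s z≤n) L<a , a≤b , a+b≡s ,
                   s≤s (subst (b ≤_) a+b≡s (m≤n+m b a)) , refl
  ... | inj₂ b≤a = b , a , ≤-trans (s≤s z≤n) L<b , b≤a , trans (+-comm b a) a+b≡s ,
                   s≤s (subst (a ≤_) a+b≡s (m≤m+n a b)) , +-comm (N ^ a) (N ^ b)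

  All-Pair-0 : ∀ {xs} → All (Pair 0) xs → xs ≡ []
  All-Pair-0 []                                 = refl
  All-Pair-0 ((_ , _ , _ , _ , _ , () , _) ∷ _)

  Pair-lower : ∀ {h x} → Pair (suc h) x → x ≢ top h → Pair h x
  Pair-lower (p , q , 1≤p , p≤q , p+q≡s , q<1+h , x≡) x≢top with m≤n⇒m<n∨m≡n (≤-pred q<1+h)
  ... | inj₁ q<h  = p , q , 1≤p , p≤q , p+q≡s , q<h , x≡
  ... | inj₂ refl = contradiction (trans x≡ (cong (λ e → N ^ e + N ^ q) p≡s∸q)) x≢top
    where
    p≡s∸q : p ≡ s ∸ q
    p≡s∸q = trans (sym (m+n∸n≡m p q)) (cong (_∸ q) p+q≡s)

  All-Pair-lower : ∀ {h xs} → All (Pair (suc h)) xs → top h ∉ xs → All (Pair h) xs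
  All-Pair-lower []         _       = []
  All-Pair-lower (px ∷ pxs) top∉xs =
    Pair-lower px (λ x≡top → top∉xs (here (sym x≡top))) ∷ All-Pair-lower pxs (top∉xs ∘ there)

  Pair-≤ : ∀ {h x} → Pair (suc h) x → x ≤ N ^ h + N ^ h
  Pair-≤ (p , q , _ , p≤q , _ , q<1+h , refl) =
    +-mono-≤ (^-monoʳ-≤ N (≤-trans p≤q (≤-pred q<1+h))) (^-monoʳ-≤ N (≤-pred q<1+h))

  -- A pair below h has smaller exponent p = s ∸ q > s ∸ h, so N^(s∸h+1) divides it.
  Pair-∣ : ∀ {h x} → Pair h x → N ^ suc (s ∸ h) ∣ x
  Pair-∣ {h} (suc p , q , _ , p≤q , refl , q<h , refl) =
    ∣m∣n⇒∣m+n (^-∣ N s∸h<1+p) (^-∣ N (≤-trans s∸h<1+p p≤q))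
    where
    s∸h<1+p : suc (suc p + q ∸ h) ≤ suc p
    s∸h<1+p = s≤s (≤-trans (∸-monoʳ-≤ (suc p + q) q<h) (≤-reflexive (m+n∸n≡m p q)))

  remove-top : ∀ {h xs ys} → xs ↭ top h ∷ ys → Unique xs → All (Pair (suc h)) xs →
               Unique ys × All (Pair h) ys
  remove-top {h} {ys = ys} σ uxs pxs =
    AllPairs.tail u , All-Pair-lower (All.tail (All-resp-↭ σ pxs)) (Unique[x∷xs]⇒x∉xs u)
    where
    u : Unique (top h ∷ ys)
    u = Unique-resp-↭ σ uxs

  sum-Unique-Pair< : ∀ h {xs} → Unique xs → All (Pair h) xs → sum xs < N ^ h
  sum-Unique-Pair< zero uxs pxs with refl ← All-Pair-0 pxs = s≤s z≤n
  sum-Unique-Pair< (suc h) {xs} uxs pxs with top h ∈? xs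
  ... | no top∉xs = <-≤-trans (sum-Unique-Pair< h uxs (All-Pair-lower pxs top∉xs)) (^-monoʳ-≤ N (n≤1+n h))
  ... | yes top∈xs with ys , σ ← ∈⇒↭∷ top∈xs with uys , pys ← remove-top σ uxs pxs = begin-strict
    sum xs                ≡⟨ sum-↭ σ ⟩
    top h + sum ys        <⟨ +-monoʳ-< (top h) (sum-Unique-Pair< h uys pys) ⟩
    top h + N ^ h         ≤⟨ +-monoˡ-≤ (N ^ h) (Pair-≤ (All.lookup pxs top∈xs)) ⟩
    N ^ h + N ^ h + N ^ h ≤⟨ thrice≤^suc h ⟩
    N ^ suc h             ∎
    where open ≤-Reasoning

  top-absent : ∀ {h xs ys} → Unique xs → All (Pair h) xs → sum xs ≡ sum ys → top h ∉ ys
  top-absent {h} {xs} {ys} uxs pxs eq top∈ys with zs , σ ← ∈⇒↭∷ top∈ys = <-irrefl eq (begin-strict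
    sum xs         <⟨ sum-Unique-Pair< h uxs pxs ⟩
    N ^ h          ≤⟨ m≤n+m (N ^ h) (N ^ (s ∸ h)) ⟩
    top h          ≤⟨ m≤m+n (top h) (sum zs) ⟩
    top h + sum zs ≡⟨ sum-↭ σ ⟨
    sum ys         ∎)
    where open ≤-Reasoning

  -- Without top h, a list of pairs below h+1 sums to a multiple of N^(s∸h+1),
  -- which top h plus pairs below h never is.
  top-forced : ∀ {h xs ys} → All (Pair h) xs → All (Pair (suc h)) ys → top h ∉ ys →
               sum ys ≢ top h + sum xs
  top-forced {h} {xs} {ys} pxs pys top∉ys eq = ^-suc-∤ (s ∸ h) h
    (∣m+n∣m⇒∣n (subst (N ^ suc (s ∸ h) ∣_) (trans eq (+-comm (top h) (sum xs))) d∣sum-ys)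
               (sum-∣ (All.map Pair-∣ pxs)))
    where
    d∣sum-ys : N ^ suc (s ∸ h) ∣ sum ys
    d∣sum-ys = sum-∣ (All.map Pair-∣ (All-Pair-lower pys top∉ys))

  pair-sums-determine : ∀ h {xs ys} → Unique xs → All (Pair h) xs → All (Pair h) ys →
                        sum xs ≡ sum ys → Unique ys × (ys ↭ xs)
  pair-sums-determine zero uxs pxs pys eq with refl ← All-Pair-0 pxs | refl ← All-Pair-0 pys = [] , ↭-refl
  pair-sums-determine (suc h) {xs} {ys} uxs pxs pys eq with top h ∈? xs
  ... | no top∉xs = pair-sums-determine h uxs pxs' (All-Pair-lower pys (top-absent uxs pxs' eq)) eq
    where
    pxs' : All (Pair h) xs
    pxs' = All-Pair-lower pxs top∉xs
  ... | yes top∈xs with xs' , σ ← ∈⇒↭∷ top∈xs with uxs' , pxs' ← remove-top σ uxs pxs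
    with ys' , τ ← ∈⇒↭∷ (decidable-stable (top h ∈? ys)
                           (λ top∉ys → top-forced pxs' pys top∉ys (trans (sym eq) (sum-↭ σ)))) =
    restore-head σ τ top∉ys' (pair-sums-determine h uxs' pxs' pys' eq')
    where
    eq' : sum xs' ≡ sum ys'
    eq' = +-cancelˡ-≡ (top h) (sum xs') (sum ys') (trans (sym (sum-↭ σ)) (trans eq (sum-↭ τ)))
    top∉ys' : top h ∉ ys'
    top∉ys' = top-absent uxs' pxs' eq'
    pys' : All (Pair h) ys'
    pys' = All-Pair-lower (All.tail (All-resp-↭ τ pys)) top∉ys'

-- With M = tΔ and e = iΔ + d ≤ 2M, the exponent 5M ∸ e still exceeds 2M.
exponent-gap : ∀ M e → 1 ≤ M → e ≤ M + M → suc (2 * M) + e ≤ 5 * M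
exponent-gap M e 1≤M e≤2M = begin
  suc (2 * M) + e         ≤⟨ +-monoʳ-≤ (suc (2 * M)) e≤2M ⟩
  suc (2 * M + (M + M))   ≡⟨ +-comm 1 (2 * M + (M + M)) ⟩
  2 * M + (M + M) + 1     ≤⟨ +-monoʳ-≤ (2 * M + (M + M)) 1≤M ⟩
  2 * M + (M + M) + M     ≡⟨ five M ⟩
  5 * M                   ∎
  where
  open ≤-Reasoning
  five : ∀ M → 2 * M + (M + M) + M ≡ 5 * M
  five = solve-∀

Z-TwoPowers : ∀ {t Δ x} → 1 ≤ t → 1 ≤ Δ → InZ t Δ x →
              TwoPowers (4 * t * Δ) (2 * t * Δ + 5 * t * Δ) (suc (2 * t * Δ)) x
Z-TwoPowers {t} {Δ} 1≤t 1≤Δ (i , d , _ , i≤t , 1≤d , d≤Δ , refl) =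
  2 * t * Δ + e , 5 * t * Δ ∸ e ,
  m<m+n (2 * t * Δ) 1≤e , m+n≤o⇒m≤o∸n (suc (2 * t * Δ)) gap , exponents-sum , refl
  where
  e : ℕ
  e = i * Δ + d
  1≤e : 1 ≤ e
  1≤e = ≤-trans 1≤d (m≤n+m d (i * Δ))
  e≤2tΔ : e ≤ t * Δ + t * Δ
  e≤2tΔ = +-mono-≤ (*-monoˡ-≤ Δ i≤t) (≤-trans d≤Δ (m≤n*m Δ t {{>-nonZero 1≤t}}))
  gap : suc (2 * t * Δ) + e ≤ 5 * t * Δ
  gap = subst (λ c → suc c + e ≤ 5 * t * Δ) (sym (*-assoc 2 t Δ))
          (subst (suc (2 * (t * Δ)) + e ≤_) (sym (*-assoc 5 t Δ))
            (exponent-gap (t * Δ) e (*-mono-≤ 1≤t 1≤Δ) e≤2tΔ))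
  exponents-sum : 2 * t * Δ + e + (5 * t * Δ ∸ e) ≡ 2 * t * Δ + 5 * t * Δ
  exponents-sum = trans (+-assoc (2 * t * Δ) e _)
    (cong (2 * t * Δ +_) (m+[n∸m]≡n (≤-trans (m≤n+m e (suc (2 * t * Δ))) gap)))

lemma3p23 : (t Δ : ℕ) → 1 ≤ t → 1 ≤ Δ →
    (A B : List ℕ) → Unique A → All (InZ t Δ) A → All (InZ t Δ) B →
    ∣ sum A - sum B ∣ < (4 * t * Δ) ^ (2 * t * Δ) →
    Unique B × (B ↭ A)
lemma3p23 t Δ 1≤t 1≤Δ A B uA zA zB close =
  pair-sums-determine (suc s) uA (All.map TwoPowers⇒Pair twoA) (All.map TwoPowers⇒Pair twoB) sumA≡sumB
  where
  N s : ℕ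
  N = 4 * t * Δ
  s = 2 * t * Δ + 5 * t * Δ
  4≤N : 4 ≤ N
  4≤N = *-mono-≤ (*-mono-≤ (≤-refl {4}) 1≤t) 1≤Δ
  open PairSums N s (≤-trans (n≤1+n 3) 4≤N)
  twoA : All (TwoPowers N s (suc (2 * t * Δ))) A
  twoA = All.map (Z-TwoPowers 1≤t 1≤Δ) zA
  twoB : All (TwoPowers N s (suc (2 * t * Δ))) B
  twoB = All.map (Z-TwoPowers 1≤t 1≤Δ) zB
  -- Both sums are multiples of N^(2tΔ+1) > N^(2tΔ) > their distance.
  sumA≡sumB : sum A ≡ sum B
  sumA≡sumB = ∣-∣<⇒≡ (sum-∣ (All.map TwoPowers-∣ twoA)) (sum-∣ (All.map TwoPowers-∣ twoB))
                     (<-≤-trans close (^-monoʳ-≤ N (n≤1+n (2 * t * Δ))))
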